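{- Let $a\ge 1$, $b\ge 0$, $c\ge 2$ be integers. Then: (i) if $a$ and $b$ are both odd, $\operatorname{GR}_2(y=x+2:y=ax^c+b)$ does not exist; (ii) if $a$ and $b$ have different parity, $\operatorname{GR}_2(y=x+2:y=ax^c+b)=a+b$; (iii) if $a$ and $b$ are both even, $\operatorname{GR}_2(y=x+2:y=ax^c+b)=a\cdot 2^c+b$.
   Context: All colorings are exact: an exact $2$-coloring of $[n]=\{1,\dots,n\}$ is a surjective map $[n]\to\{1,2\}$. A rainbow solution of $y=x+2$ in $[n]$ is a pair $x_0,x_0+2\in[n]$ of different colors. A monochromatic solution of $y=ax^c+b$ in $[n]$ is a pair $x_0,y_0\in[n]$ with $y_0=ax_0^c+b$ and $x_0,y_0$ of the same color. The Gallai--Rado number $\operatorname{GR}_k(\mathcal{E}_1:\mathcal{E}_2)$ is the minimum positive integer $N$, if it exists, such that for all $n\ge N$, every exact $k$-coloring of $[n]$ contains either a rainbow solution of $\mathcal{E}_1$ or a monochromatic solution of $\mathcal{E}_2$. -}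

module Defs where

open import Data.Nat using (ℕ; _+_; _*_; _^_; _≤_; _<_; _≥_)
open import Data.Nat.Divisibility using (_∣_; _∤_)
open import Data.Fin using (Fin)
open import Data.Product using (Σ; ∃; _×_; _,_)
open import Relation.Binary.PropositionalEquality using (_≡_; _≢_)
open import Relation.Nullary using (¬_)

-- A 2-coloring; only its values on [n] = {1,…,n} are relevant.
Coloring : Set
Coloring = ℕ → Fin 2

InRange : ℕ → ℕ → Set
InRange n x = 1 ≤ x × x ≤ n

Exact : ℕ → Coloring → Set
Exact n χ = (k : Fin 2) → ∃ λ x → InRange n x × χ x ≡ k

RainbowShift2 : ℕ → Coloring → Set
RainbowShift2 n χ = ∃ λ x → InRange n x × InRange n (x + 2) × χ x ≢ χ (x + 2)

MonoPoly : ℕ → ℕ → ℕ → ℕ → Coloring → Set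
MonoPoly a b c n χ =
  Σ ℕ λ x → Σ ℕ λ y → InRange n x × InRange n y × y ≡ a * x ^ c + b × χ x ≡ χ y

Forces : ℕ → ℕ → ℕ → ℕ → Set
Forces a b c n = (χ : Coloring) → Exact n χ →
  RainbowShift2 n χ Data.Sum.⊎ MonoPoly a b c n χ
  where import Data.Sum

GoodFrom : ℕ → ℕ → ℕ → ℕ → Set
GoodFrom a b c N = (n : ℕ) → n ≥ N → Forces a b c n

IsGR : ℕ → ℕ → ℕ → ℕ → Set
IsGR a b c N = 1 ≤ N × GoodFrom a b c N ×
  ((M : ℕ) → 1 ≤ M → M < N → ¬ GoodFrom a b c M)

GRExists : ℕ → ℕ → ℕ → Set
GRExists a b c = ∃ λ N → 1 ≤ N × GoodFrom a b c N

Even : ℕ → Set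
Even n = 2 ∣ n

Odd : ℕ → Set
Odd n = 2 ∤ n

-- A coloring with no rainbow solution of y = x + 2 is constant on each parity class of [n],
-- and coloring by parity is such a coloring.  So for n ≥ 2, [n] is forcing exactly when some
-- solution y = a x^c + b ≤ n has x ≡ y (mod 2); and modulo 2, a x^c + b ≡ a x + b.
-- If a and b are odd, x and y always have opposite parities.  If a + b is odd, every solution
-- has y ≥ a + b, and x = 1, y = a + b has the right parity.  If a and b are even, y is even,
-- so only even x ≥ 2 can help, and x = 2 gives y = a 2^c + b.
module Submission where

open import Defs
open import Data.Nat using (ℕ; _+_; _*_; _^_; _≤_)
open import Data.Product using (_×_)
open import Relation.Nullary using (¬_)

open import Data.Nat using (zero; suc; pred; parity; z≤n; s≤s; >-nonZero)
open import Data.Nat.Properties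
open import Data.Nat.Divisibility using (divides)
open import Data.Parity.Base as ℙ using (Parity; 0ℙ; 1ℙ; _⁻¹)
import Data.Parity.Properties as ℙₚ
open import Data.Fin using (Fin) renaming (zero to fzero; suc to fsuc; _≟_ to _≟ᶠ_)
open import Data.Product using (∃; _,_)
open import Data.Sum using (_⊎_; inj₁; inj₂)
open import Data.Empty using (⊥-elim)
open import Function using (_∘_)
open import Relation.Nullary using (yes; no)
open import Relation.Binary.PropositionalEquality
open ≡-Reasoning

even⇒parity≡0ℙ : ∀ {n} → Even n → parity n ≡ 0ℙ
even⇒parity≡0ℙ (divides q refl) = trans (ℙₚ.*-homo-* q 2) (ℙₚ.*-zeroʳ (parity q))

parity≡0ℙ⇒even : ∀ n → parity n ≡ 0ℙ → Even n
parity≡0ℙ⇒even zero          _ = divides 0 refl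
parity≡0ℙ⇒even (suc (suc n)) p with parity≡0ℙ⇒even n p
... | divides q n≡q*2 = divides (suc q) (cong (2 +_) n≡q*2)

odd⇒parity≡1ℙ : ∀ {n} → Odd n → parity n ≡ 1ℙ
odd⇒parity≡1ℙ {n} odd with parity n in p
... | 0ℙ = ⊥-elim (odd (parity≡0ℙ⇒even n p))
... | 1ℙ = refl

parity≡0ℙ⇒2≤ : ∀ {n} → parity n ≡ 0ℙ → 1 ≤ n → 2 ≤ n
parity≡0ℙ⇒2≤ {suc (suc _)} _ _ = s≤s (s≤s z≤n)

parity-pred : ∀ {n} → 1 ≤ n → parity (pred n) ≡ parity n ⁻¹
parity-pred {suc n} _ = sym (ℙₚ.suc-homo-⁻¹ n)

parity-suc-injective : ∀ {x y} → parity (suc x) ≡ parity (suc y) → parity x ≡ parity y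
parity-suc-injective {x} {y} p =
  trans (sym (ℙₚ.suc-homo-⁻¹ x)) (trans (cong _⁻¹ p) (ℙₚ.suc-homo-⁻¹ y))

parity[n+2]≡parity[n] : ∀ n → parity (n + 2) ≡ parity n
parity[n+2]≡parity[n] n = trans (ℙₚ.+-homo-+ n 2) (ℙₚ.+-identityʳ (parity n))

parity-^ : ∀ x {c} → 1 ≤ c → parity (x ^ c) ≡ parity x
parity-^ x {suc zero}    _ = trans (ℙₚ.*-homo-* x 1) (ℙₚ.*-identityʳ (parity x))
parity-^ x {suc (suc c)} _ = begin
  parity (x * x ^ suc c)          ≡⟨ ℙₚ.*-homo-* x (x ^ suc c) ⟩
  parity x ℙ.* parity (x ^ suc c) ≡⟨ cong (parity x ℙ.*_) (parity-^ x {suc c} (s≤s z≤n)) ⟩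
  parity x ℙ.* parity x           ≡⟨ ℙₚ.*-idem (parity x) ⟩
  parity x                        ∎

parity-poly : ∀ a b x {c} → 1 ≤ c →
  parity (a * x ^ c + b) ≡ (parity a ℙ.* parity x) ℙ.+ parity b
parity-poly a b x {c} c≥1 = begin
  parity (a * x ^ c + b)                     ≡⟨ ℙₚ.+-homo-+ (a * x ^ c) b ⟩
  parity (a * x ^ c) ℙ.+ parity b            ≡⟨ cong (ℙ._+ parity b) (ℙₚ.*-homo-* a (x ^ c)) ⟩
  (parity a ℙ.* parity (x ^ c)) ℙ.+ parity b ≡⟨ cong (λ p → (parity a ℙ.* p) ℙ.+ parity b) (parity-^ x c≥1) ⟩
  (parity a ℙ.* parity x) ℙ.+ parity b       ∎

sameParity⇒≡*2+ : ∀ {x y} → x ≤ y → parity x ≡ parity y → ∃ λ k → y ≡ k * 2 + x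
sameParity⇒≡*2+ {y = y} z≤n p with parity≡0ℙ⇒even y (sym p)
... | divides k y≡k*2 = k , trans y≡k*2 (sym (+-identityʳ (k * 2)))
sameParity⇒≡*2+ {suc x} {suc y} (s≤s x≤y) p with sameParity⇒≡*2+ x≤y (parity-suc-injective {x} {y} p)
... | k , y≡k*2+x = k , trans (cong suc y≡k*2+x) (sym (+-suc (k * 2) x))

poly-mono-≤ : ∀ a b c {x y} → x ≤ y → a * x ^ c + b ≤ a * y ^ c + b
poly-mono-≤ a b c x≤y = +-monoˡ-≤ b (*-monoʳ-≤ a (^-monoˡ-≤ c x≤y))

rainbow⊎sameColour[+2] : ∀ {n} (χ : Coloring) {u} → InRange n u → InRange n (u + 2) →
  RainbowShift2 n χ ⊎ χ u ≡ χ (u + 2)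
rainbow⊎sameColour[+2] χ {u} u∈ u+2∈ with χ u ≟ᶠ χ (u + 2)
... | yes same = inj₂ same
... | no  differ = inj₁ (u , u∈ , u+2∈ , differ)

rainbow⊎sameColour[*2+] : ∀ {n} (χ : Coloring) {x} → 1 ≤ x → ∀ k → k * 2 + x ≤ n →
  RainbowShift2 n χ ⊎ χ x ≡ χ (k * 2 + x)
rainbow⊎sameColour[*2+] χ x≥1 zero    _ = inj₂ refl
rainbow⊎sameColour[*2+] {n} χ {x} x≥1 (suc k) 2+u≤n =
  extend (rainbow⊎sameColour[*2+] χ x≥1 k u≤n)
         (rainbow⊎sameColour[+2] χ (u≥1 , u≤n) (≤-trans u≥1 (m≤m+n u 2) , subst (_≤ n) (+-comm 2 u) 2+u≤n))
  where
  u : ℕ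
  u = k * 2 + x
  u≥1 : 1 ≤ u
  u≥1 = ≤-trans x≥1 (m≤n+m x (k * 2))
  u≤n : u ≤ n
  u≤n = ≤-trans (m≤n+m u 2) 2+u≤n
  extend : RainbowShift2 n χ ⊎ χ x ≡ χ u → RainbowShift2 n χ ⊎ χ u ≡ χ (u + 2) →
           RainbowShift2 n χ ⊎ χ x ≡ χ (2 + u)
  extend (inj₁ rainbow) _              = inj₁ rainbow
  extend _              (inj₁ rainbow) = inj₁ rainbow
  extend (inj₂ χx≡χu)   (inj₂ χu≡χu+2) = inj₂ (trans χx≡χu (trans χu≡χu+2 (cong χ (+-comm u 2))))

goodFrom-sameParitySolution : ∀ a b c {x y} → 1 ≤ x → x ≤ y → y ≡ a * x ^ c + b →
  parity x ≡ parity y → GoodFrom a b c y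
goodFrom-sameParitySolution a b c {x} x≥1 x≤y y≡ p n y≤n χ _ with sameParity⇒≡*2+ x≤y p
... | k , refl with rainbow⊎sameColour[*2+] χ x≥1 k y≤n
...   | inj₁ rainbow = inj₁ rainbow
...   | inj₂ same    = inj₂ (x , _ , (x≥1 , ≤-trans x≤y y≤n) , (≤-trans x≥1 x≤y , y≤n) , y≡ , same)

fromParity : Parity → Fin 2
fromParity 0ℙ = fzero
fromParity 1ℙ = fsuc fzero

fromParity-injective : ∀ {p q} → fromParity p ≡ fromParity q → p ≡ q
fromParity-injective {0ℙ} {0ℙ} _ = refl
fromParity-injective {1ℙ} {1ℙ} _ = refl

parityColoring : Coloring
parityColoring = fromParity ∘ parity

parityColoring-exact : ∀ {n} → 2 ≤ n → Exact n parityColoring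
parityColoring-exact 2≤n fzero        = 2 , (s≤s z≤n , 2≤n) , refl
parityColoring-exact 2≤n (fsuc fzero) = 1 , (≤-refl , ≤-trans (n≤1+n 1) 2≤n) , refl

parityColoring-rainbowFree : ∀ {n} → ¬ RainbowShift2 n parityColoring
parityColoring-rainbowFree (x , _ , _ , differ) =
  differ (cong fromParity (sym (parity[n+2]≡parity[n] x)))

¬forces-ifParityChanges : ∀ a b c {n} → 2 ≤ n →
  (∀ {x} → InRange n x → a * x ^ c + b ≤ n → parity x ≢ parity (a * x ^ c + b)) →
  ¬ Forces a b c n
¬forces-ifParityChanges a b c 2≤n changes forces with forces parityColoring (parityColoring-exact 2≤n)
... | inj₁ rainbow = parityColoring-rainbowFree rainbow
... | inj₂ (_ , _ , x∈ , (_ , y≤n) , refl , same) = changes x∈ y≤n (fromParity-injective same)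

isGR-intro : ∀ a b c {N} → 1 ≤ N → GoodFrom a b c N →
  (1 ≤ pred N → ¬ Forces a b c (pred N)) → IsGR a b c N
isGR-intro a b c {N} N≥1 good fails = N≥1 , good , λ M M≥1 M<N goodM →
  let M≤pred = <⇒≤pred M<N in fails (≤-trans M≥1 M≤pred) (goodM (pred N) M≤pred)

¬grExists-oddOdd : ∀ a b c → 1 ≤ c → parity a ≡ 1ℙ → parity b ≡ 1ℙ → ¬ GRExists a b c
¬grExists-oddOdd a b c c≥1 pa pb (N , _ , good) =
  ¬forces-ifParityChanges a b c (m≤n+m 2 N) (λ {x} _ _ → parityChanges x) (good (N + 2) (m≤m+n N 2))
  where
  parityChanges : ∀ x → parity x ≢ parity (a * x ^ c + b)
  parityChanges x same = ℙₚ.p≢p⁻¹ (parity x) (begin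
    parity x                             ≡⟨ same ⟩
    parity (a * x ^ c + b)               ≡⟨ parity-poly a b x c≥1 ⟩
    (parity a ℙ.* parity x) ℙ.+ parity b ≡⟨ cong₂ (λ p q → (p ℙ.* parity x) ℙ.+ q) pa pb ⟩
    parity x ℙ.+ 1ℙ                      ≡⟨ ℙₚ.+-comm (parity x) 1ℙ ⟩
    parity x ⁻¹                          ∎)

isGR-mixedParity : ∀ a b c → 1 ≤ a → parity (a + b) ≡ 1ℙ → IsGR a b c (a + b)
isGR-mixedParity a b c a≥1 p = isGR-intro a b c N≥1 good fails
  where
  N≥1 : 1 ≤ a + b
  N≥1 = ≤-trans a≥1 (m≤m+n a b)
  a*1^c+b≡a+b : a * 1 ^ c + b ≡ a + b
  a*1^c+b≡a+b = cong (_+ b) (trans (cong (a *_) (^-zeroˡ c)) (*-identityʳ a))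
  good : GoodFrom a b c (a + b)
  good = goodFrom-sameParitySolution a b c ≤-refl N≥1 (sym a*1^c+b≡a+b) (sym p)
  fails : 1 ≤ pred (a + b) → ¬ Forces a b c (pred (a + b))
  fails m≥1 = ¬forces-ifParityChanges a b c (parity≡0ℙ⇒2≤ (trans (parity-pred N≥1) (cong _⁻¹ p)) m≥1)
    λ {x} (x≥1 , _) y≤m _ → <⇒≱ (m≤pred[n]⇒suc[m]≤n {{>-nonZero N≥1}} y≤m)
                            (subst (_≤ a * x ^ c + b) a*1^c+b≡a+b (poly-mono-≤ a b c x≥1))

isGR-evenEven : ∀ a b c → 1 ≤ a → 1 ≤ c → parity a ≡ 0ℙ → parity b ≡ 0ℙ →
  IsGR a b c (a * 2 ^ c + b)
isGR-evenEven a b c a≥1 c≥1 pa pb = isGR-intro a b c N≥1 good fails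
  where
  N : ℕ
  N = a * 2 ^ c + b
  parity-solution : ∀ x → parity (a * x ^ c + b) ≡ 0ℙ
  parity-solution x = trans (parity-poly a b x c≥1) (cong₂ (λ p q → (p ℙ.* parity x) ℙ.+ q) pa pb)
  4≤N : 4 ≤ N
  4≤N = ≤-trans (*-mono-≤ (parity≡0ℙ⇒2≤ pa a≥1) (^-monoʳ-≤ 2 c≥1)) (m≤m+n (a * 2 ^ c) b)
  N≥1 : 1 ≤ N
  N≥1 = ≤-trans (s≤s z≤n) 4≤N
  good : GoodFrom a b c N
  good = goodFrom-sameParitySolution a b c (s≤s z≤n) (≤-trans (s≤s (s≤s z≤n)) 4≤N) refl
                                     (sym (parity-solution 2))
  changes : ∀ {x} → InRange (pred N) x → a * x ^ c + b ≤ pred N → parity x ≢ parity (a * x ^ c + b)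
  changes {x} (x≥1 , _) y≤m same with parity x in px
  ... | 0ℙ = <⇒≱ (m≤pred[n]⇒suc[m]≤n {{>-nonZero N≥1}} y≤m) (poly-mono-≤ a b c (parity≡0ℙ⇒2≤ px x≥1))
  ... | 1ℙ = ℙₚ.p≢p⁻¹ 1ℙ (trans same (parity-solution x))
  fails : 1 ≤ pred N → ¬ Forces a b c (pred N)
  fails _ = ¬forces-ifParityChanges a b c (≤-trans (s≤s (s≤s z≤n)) (pred-mono-≤ 4≤N)) changes

mainTheorem7 : (a b c : ℕ) → 1 ≤ a → 2 ≤ c →
    ((Odd a × Odd b) → ¬ GRExists a b c) ×
    (((Odd a × Even b) → IsGR a b c (a + b)) × ((Even a × Odd b) → IsGR a b c (a + b))) ×
    ((Even a × Even b) → IsGR a b c (a * 2 ^ c + b))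
mainTheorem7 a b c a≥1 c≥2 =
  (λ (oa , ob) → ¬grExists-oddOdd a b c c≥1 (odd⇒parity≡1ℙ oa) (odd⇒parity≡1ℙ ob)) ,
  ( (λ (oa , eb) → isGR-mixedParity a b c a≥1 (parity-sum (odd⇒parity≡1ℙ oa) (even⇒parity≡0ℙ eb)))
  , (λ (ea , ob) → isGR-mixedParity a b c a≥1 (parity-sum (even⇒parity≡0ℙ ea) (odd⇒parity≡1ℙ ob)))) ,
  (λ (ea , eb) → isGR-evenEven a b c a≥1 c≥1 (even⇒parity≡0ℙ ea) (even⇒parity≡0ℙ eb))
  where
  c≥1 : 1 ≤ c
  c≥1 = <⇒≤ c≥2
  parity-sum : ∀ {p q} → parity a ≡ p → parity b ≡ q → parity (a + b) ≡ p ℙ.+ q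
  parity-sum pa pb = trans (ℙₚ.+-homo-+ a b) (cong₂ ℙ._+_ pa pb)
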